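{- Let $W$ be a PLTL formula and $\sigma$ a model with $(\sigma,0)\models W$. Then there exists a model $\sigma'$ such that $(\sigma',0)\models\tau_0[W]$.
   Context: PLTL formulae are built from proposition symbols, $\mathbf{true}$, $\mathbf{false}$, $\neg,\vee,\wedge,\Rightarrow$ and temporal operators $\bigcirc$ (next), $\Diamond$ (sometime), $\Box$ (always), $\mathcal{U}$ (until), $\mathcal{W}$ (unless). A model is an infinite sequence $\sigma=s_0,s_1,\dots$ of sets of proposition symbols; $(\sigma,i)\models p$ iff $p\in s_i$; Boolean connectives as usual; $\bigcirc A$ at $i$ iff $A$ at $i+1$; $\Diamond A$ at $i$ iff $A$ at some $k\ge i$; $\Box A$ at $i$ iff $A$ at all $j\ge i$; $A\,\mathcal{U}\,B$ at $i$ iff $B$ at some $k\ge i$ and $A$ at all $j$, $i\le j<k$; $A\,\mathcal{W}\,B$ iff $A\,\mathcal{U}\,B$ or $\Box A$. $\mathbf{start}$ holds exactly at index $0$. A literal is a proposition symbol or its negation. A PLTL-clause is $\mathbf{start}\Rightarrow\bigvee_c l_c$, $\bigwedge_a k_a\Rightarrow\bigcirc\bigvee_d l_d$ or $\bigwedge_b k_b\Rightarrow\Diamond l$ with all $k,l$ literals. The translation: $\tau_0[A]=\Box(\mathbf{start}\Rightarrow y)\wedge\tau_1[\Box(y\Rightarrow A)]$ with $y$ a fresh proposition symbol, where $\tau_1$, applied to $\Box(x\Rightarrow W)$ ($x$ a proposition symbol), is computed by applying the following rewrite rules repeatedly until the result is a conjunction of formulae $\Box A_i$, each $A_i$ a PLTL-clause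 (write $\tau_1[x\Rightarrow A]$ for $\tau_1[\Box(x\Rightarrow A)]$; $y,z,v$ are proposition symbols new at each application; $l,m,l_i$ literals; $\neg\mathbf{true}$, $\neg\mathbf{false}$ rewritten to $\mathbf{false}$, $\mathbf{true}$). (1) $x\Rightarrow(A\wedge B)\mapsto\tau_1[x\Rightarrow A]\wedge\tau_1[x\Rightarrow B]$; $x\Rightarrow(A\Rightarrow B)\mapsto\tau_1[x\Rightarrow\neg A\vee B]$; $x\Rightarrow\neg(A\wedge B)\mapsto\tau_1[x\Rightarrow\neg A\vee\neg B]$; $x\Rightarrow\neg(A\Rightarrow B)\mapsto\tau_1[x\Rightarrow A]\wedge\tau_1[x\Rightarrow\neg B]$; $x\Rightarrow\neg(A\vee B)\mapsto\tau_1[x\Rightarrow\neg A]\wedge\tau_1[x\Rightarrow\neg B]$. (2) $x\Rightarrow\bigcirc A\mapsto\Box(x\Rightarrow\bigcirc y)\wedge\tau_1[y\Rightarrow A]$ if $A$ is neither a literal nor a disjunction of literals; $x\Rightarrow\neg\bigcirc A\mapsto\Box(x\Rightarrow\bigcirc y)\wedge\tau_1[y\Rightarrow\neg A]$; $x\Rightarrow\Box A\mapsto\tau_1[x\Rightarrow\Box y]\wedge\tau_1[y\Rightarrow A]$ ($A$ not a literal); $x\Rightarrow\neg\Box A\mapsto\Box(x\Rightarrow\Diamond y)\wedge\tau_1[y\Rightarrow\neg A]$; $x\Rightarrow\Diamond A\mapsto\Box(x\Rightarrow\Diamond y)\wedge\tau_1[y\Rightarrow A]$ ($A$ not a literal);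 $x\Rightarrow\neg\Diamond A\mapsto\tau_1[x\Rightarrow\Box y]\wedge\tau_1[y\Rightarrow\neg A]$; $x\Rightarrow A\,\mathcal{U}\,B\mapsto\tau_1[x\Rightarrow y\,\mathcal{U}\,B]\wedge\tau_1[y\Rightarrow A]$ ($A$ not a literal), $\mapsto\tau_1[x\Rightarrow A\,\mathcal{U}\,y]\wedge\tau_1[y\Rightarrow B]$ ($B$ not a literal); the same with $\mathcal{W}$ for $\mathcal{U}$; $x\Rightarrow\neg(A\,\mathcal{U}\,B)\mapsto\tau_1[x\Rightarrow y\,\mathcal{W}\,v]\wedge\tau_1[y\Rightarrow\neg B]\wedge\tau_1[v\Rightarrow(y\wedge z)]\wedge\tau_1[z\Rightarrow\neg A]$; $x\Rightarrow\neg(A\,\mathcal{W}\,B)\mapsto\tau_1[x\Rightarrow y\,\mathcal{U}\,v]\wedge\tau_1[y\Rightarrow\neg B]\wedge\tau_1[v\Rightarrow(y\wedge z)]\wedge\tau_1[z\Rightarrow\neg A]$. (3) $x\Rightarrow\Box l\mapsto\tau_1[x\Rightarrow l]\wedge\tau_1[x\Rightarrow y]\wedge\Box(y\Rightarrow\bigcirc l)\wedge\Box(y\Rightarrow\bigcirc y)$; $x\Rightarrow l\,\mathcal{U}\,m\mapsto\Box(x\Rightarrow\Diamond m)\wedge\tau_1[x\Rightarrow l\vee m]\wedge\tau_1[x\Rightarrow y\vee m]\wedge\Box(y\Rightarrow\bigcirc(l\vee m))\wedge\Box(y\Rightarrow\bigcirc(y\vee m))$; $x\Rightarrow l\,\mathcal{W}\,m\mapsto$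 the same without $\Box(x\Rightarrow\Diamond m)$. (4) $x\Rightarrow D\vee A\mapsto\tau_1[x\Rightarrow D\vee y]\wedge\tau_1[y\Rightarrow A]$, $D$ a disjunction, $A$ neither a literal nor a disjunction of literals. (5) $x\Rightarrow D\mapsto\Box(\mathbf{start}\Rightarrow\neg x\vee D)\wedge\Box(\mathbf{true}\Rightarrow\bigcirc(\neg x\vee D))$ for $D$ a literal or disjunction of literals; $x\Rightarrow\mathbf{true}\mapsto\Box(\mathbf{start}\Rightarrow\mathbf{true})\wedge\Box(\mathbf{true}\Rightarrow\bigcirc\mathbf{true})$; $x\Rightarrow\mathbf{false}\mapsto\Box(\mathbf{start}\Rightarrow\neg x)\wedge\Box(\mathbf{true}\Rightarrow\bigcirc\neg x)$; $\tau_1[x\Rightarrow\Diamond l]=\Box(x\Rightarrow\Diamond l)$; $\tau_1[x\Rightarrow\bigcirc(l_1\vee\dots\vee l_n)]=\Box(x\Rightarrow\bigcirc(l_1\vee\dots\vee l_n))$. $\tau_0[\cdot]$ denotes the final result. -}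

module Defs where

open import Data.Nat using (ℕ; zero; suc; _≤_; _<_; _⊔_)
open import Data.Bool using (Bool; true; false; not)
open import Data.List using (List; []; _∷_; _++_)
open import Data.List.Relation.Unary.All using (All)
open import Data.List.Relation.Unary.Any using (Any)
open import Data.Maybe using (Maybe; just; nothing)
open import Data.Product using (_×_; _,_; ∃; Σ)
open import Data.Sum using (_⊎_)
open import Data.Unit using (⊤)
open import Data.Empty using (⊥)
open import Relation.Nullary using (¬_)
open import Relation.Binary.PropositionalEquality using (_≡_)

infixr 4 _⇒ₜ_
infixr 5 _∨ₜ_
infixr 6 _∧ₜ_

data Form : Set where
  var   : ℕ → Form
  trueₜ  : Form
  falseₜ : Form
  ¬ₜ_   : Form → Form
  _∨ₜ_  : Form → Form → Form
  _∧ₜ_  : Form → Form → Form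
  _⇒ₜ_  : Form → Form → Form
  ○_    : Form → Form
  ◇_    : Form → Form
  □_    : Form → Form
  _𝒰_   : Form → Form → Form
  _𝒲_   : Form → Form → Form

Model : Set₁
Model = ℕ → ℕ → Set     -- σ i p  means  p ∈ s_i

_,_⊨_ : Model → ℕ → Form → Set
σ , i ⊨ var p    = σ i p
σ , i ⊨ trueₜ    = ⊤
σ , i ⊨ falseₜ   = ⊥
σ , i ⊨ (¬ₜ A)   = ¬ (σ , i ⊨ A)
σ , i ⊨ (A ∨ₜ B) = (σ , i ⊨ A) ⊎ (σ , i ⊨ B)
σ , i ⊨ (A ∧ₜ B) = (σ , i ⊨ A) × (σ , i ⊨ B)
σ , i ⊨ (A ⇒ₜ B) = (σ , i ⊨ A) → (σ , i ⊨ B)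
σ , i ⊨ (○ A)    = σ , suc i ⊨ A
σ , i ⊨ (◇ A)    = ∃ λ k → i ≤ k × (σ , k ⊨ A)
σ , i ⊨ (□ A)    = ∀ j → i ≤ j → σ , j ⊨ A
σ , i ⊨ (A 𝒰 B)  = ∃ λ k → i ≤ k × (σ , k ⊨ B) × (∀ j → i ≤ j → j < k → σ , j ⊨ A)
σ , i ⊨ (A 𝒲 B)  = (∃ λ k → i ≤ k × (σ , k ⊨ B) × (∀ j → i ≤ j → j < k → σ , j ⊨ A))
                   ⊎ (∀ j → i ≤ j → σ , j ⊨ A)

data Lit : Set where
  pos : ℕ → Lit
  neg : ℕ → Lit

-- right-hand side of initial/step clauses: a disjunction of literals,
-- or the constant true (needed for the clauses produced by x ⇒ true)
data Disj : Set where
  dtrue : Disj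
  dor   : List Lit → Disj

data Clause : Set where
  initial : Disj → Clause               -- start ⇒ ⋁ l
  step    : List Lit → Disj → Clause    -- ⋀ k ⇒ ○ ⋁ l   ([] = true)
  sometime : List Lit → Lit → Clause    -- ⋀ k ⇒ ◇ l    ([] = true)

_,_⊨ₗ_ : Model → ℕ → Lit → Set
σ , i ⊨ₗ pos p = σ i p
σ , i ⊨ₗ neg p = ¬ (σ i p)

_,_⊨d_ : Model → ℕ → Disj → Set
σ , i ⊨d dtrue  = ⊤
σ , i ⊨d dor ls = Any (λ l → σ , i ⊨ₗ l) ls

_,_⊨k_ : Model → ℕ → List Lit → Set
σ , i ⊨k ks = All (λ l → σ , i ⊨ₗ l) ks

-- (σ , i) ⊨ □ C, where start holds exactly at index 0
_,_⊨□_ : Model → ℕ → Clause → Set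
σ , i ⊨□ initial D  = ∀ j → i ≤ j → j ≡ 0 → σ , j ⊨d D
σ , i ⊨□ step ks D  = ∀ j → i ≤ j → σ , j ⊨k ks → σ , suc j ⊨d D
σ , i ⊨□ sometime ks l = ∀ j → i ≤ j → σ , j ⊨k ks → ∃ λ k → j ≤ k × (σ , k ⊨ₗ l)

_,_⊨c_ : Model → ℕ → List Clause → Set
σ , i ⊨c cs = All (λ c → σ , i ⊨□ c) cs

-- The translation τ₁, with fresh symbols drawn from a counter.
-- A target "x ⇒ A" is represented by x, a polarity b (true: A,
-- false: ¬A) and A.

St : Set → Set
St A = ℕ → A × ℕ

lit : Bool → ℕ → Lit
lit true  p = pos p
lit false p = neg p

-- rule (5): x ⇒ D  for D a disjunction of literals
base : ℕ → List Lit → List Clause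
base x ls = initial (dor (neg x ∷ ls)) ∷ step [] (dor (neg x ∷ ls)) ∷ []

baseTrue : List Clause
baseTrue = initial dtrue ∷ step [] dtrue ∷ []

baseFalse : ℕ → List Clause
baseFalse x = initial (dor (neg x ∷ [])) ∷ step [] (dor (neg x ∷ [])) ∷ []

alwaysLit : ℕ → Lit → St (List Clause)
alwaysLit x l y = (base x (l ∷ []) ++ base x (pos y ∷ [])
                   ++ step (pos y ∷ []) (dor (l ∷ [])) ∷ step (pos y ∷ []) (dor (pos y ∷ [])) ∷ [])
                  , suc y

unlessLit : ℕ → Lit → Lit → St (List Clause)
unlessLit x l m y = (base x (l ∷ m ∷ []) ++ base x (pos y ∷ m ∷ [])
                     ++ step (pos y ∷ []) (dor (l ∷ m ∷ []))
                     ∷ step (pos y ∷ []) (dor (pos y ∷ m ∷ [])) ∷ [])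
                    , suc y

untilLit : ℕ → Lit → Lit → St (List Clause)
untilLit x l m n with unlessLit x l m n
... | cs , n' = (sometime (pos x ∷ []) m ∷ cs) , n'

litDisj : Form → Maybe (List Lit)
litDisj (var p)        = just (pos p ∷ [])
litDisj (¬ₜ (var p))   = just (neg p ∷ [])
litDisj (A ∨ₜ B) with litDisj A | litDisj B
... | just ls | just ms = just (ls ++ ms)
... | _       | _       = nothing
litDisj _              = nothing

mutual
  τ₁ : ℕ → Bool → Form → St (List Clause)
  τ₁ x b     (var p)  n = base x (lit b p ∷ []) , n
  τ₁ x true  trueₜ    n = baseTrue , n
  τ₁ x false falseₜ   n = baseTrue , n
  τ₁ x true  falseₜ   n = baseFalse x , n
  τ₁ x false trueₜ    n = baseFalse x , n
  τ₁ x b     (¬ₜ A)   n = τ₁ x (not b) A n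
  τ₁ x true  (A ∧ₜ B) n with τ₁ x true A n
  ... | cs , n₁ with τ₁ x true B n₁
  ... | ds , n₂ = cs ++ ds , n₂
  τ₁ x false (A ∨ₜ B) n with τ₁ x false A n
  ... | cs , n₁ with τ₁ x false B n₁
  ... | ds , n₂ = cs ++ ds , n₂
  τ₁ x false (A ⇒ₜ B) n with τ₁ x true A n
  ... | cs , n₁ with τ₁ x false B n₁
  ... | ds , n₂ = cs ++ ds , n₂
  τ₁ x true  (A ∨ₜ B) n with dj true A n
  ... | (ls , cs) , n₁ with dj true B n₁
  ... | (ms , ds) , n₂ = base x (ls ++ ms) ++ cs ++ ds , n₂
  τ₁ x true  (A ⇒ₜ B) n with dj false A n
  ... | (ls , cs) , n₁ with dj true B n₁
  ... | (ms , ds) , n₂ = base x (ls ++ ms) ++ cs ++ ds , n₂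
  τ₁ x false (A ∧ₜ B) n with dj false A n
  ... | (ls , cs) , n₁ with dj false B n₁
  ... | (ms , ds) , n₂ = base x (ls ++ ms) ++ cs ++ ds , n₂
  τ₁ x true  (○ A) n with litDisj A
  ... | just ls = step (pos x ∷ []) (dor ls) ∷ [] , n
  ... | nothing with τ₁ n true A (suc n)
  ... | cs , n₁ = step (pos x ∷ []) (dor (pos n ∷ [])) ∷ cs , n₁
  τ₁ x false (○ A) n with τ₁ n false A (suc n)
  ... | cs , n₁ = step (pos x ∷ []) (dor (pos n ∷ [])) ∷ cs , n₁
  τ₁ x true  (□ var p) n = alwaysLit x (pos p) n
  τ₁ x true  (□ (¬ₜ var p)) n = alwaysLit x (neg p) n
  τ₁ x true  (□ A) n with alwaysLit x (pos n) (suc n)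
  ... | cs , n₁ with τ₁ n true A n₁
  ... | ds , n₂ = cs ++ ds , n₂
  τ₁ x false (□ A) n with τ₁ n false A (suc n)
  ... | cs , n₁ = sometime (pos x ∷ []) (pos n) ∷ cs , n₁
  τ₁ x true  (◇ var p) n = sometime (pos x ∷ []) (pos p) ∷ [] , n
  τ₁ x true  (◇ (¬ₜ var p)) n = sometime (pos x ∷ []) (neg p) ∷ [] , n
  τ₁ x true  (◇ A) n with τ₁ n true A (suc n)
  ... | cs , n₁ = sometime (pos x ∷ []) (pos n) ∷ cs , n₁
  τ₁ x false (◇ A) n with alwaysLit x (pos n) (suc n)
  ... | cs , n₁ with τ₁ n false A n₁
  ... | ds , n₂ = cs ++ ds , n₂
  τ₁ x true  (A 𝒰 B) n with lt A n
  ... | (l , cs) , n₁ with lt B n₁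
  ... | (m , ds) , n₂ with untilLit x l m n₂
  ... | es , n₃ = es ++ cs ++ ds , n₃
  τ₁ x true  (A 𝒲 B) n with lt A n
  ... | (l , cs) , n₁ with lt B n₁
  ... | (m , ds) , n₂ with unlessLit x l m n₂
  ... | es , n₃ = es ++ cs ++ ds , n₃
  -- ¬(A 𝒰 B): y = n, v = suc n, z = suc (suc n)
  τ₁ x false (A 𝒰 B) n with unlessLit x (pos n) (pos (suc n)) (suc (suc (suc n)))
  ... | cs , n₁ with τ₁ n false B n₁
  ... | ds , n₂ with τ₁ (suc (suc n)) false A n₂
  ... | es , n₃ = cs ++ ds ++ base (suc n) (pos n ∷ []) ++ base (suc n) (pos (suc (suc n)) ∷ []) ++ es , n₃
  τ₁ x false (A 𝒲 B) n with untilLit x (pos n) (pos (suc n)) (suc (suc (suc n)))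
  ... | cs , n₁ with τ₁ n false B n₁
  ... | ds , n₂ with τ₁ (suc (suc n)) false A n₂
  ... | es , n₃ = cs ++ ds ++ base (suc n) (pos n ∷ []) ++ base (suc n) (pos (suc (suc n)) ∷ []) ++ es , n₃

  dj : Bool → Form → St (List Lit × List Clause)
  dj b    (var p)  n = (lit b p ∷ [] , []) , n
  dj b    (¬ₜ A)   n = dj (not b) A n
  dj true (A ∨ₜ B) n with dj true A n
  ... | (ls , cs) , n₁ with dj true B n₁
  ... | (ms , ds) , n₂ = (ls ++ ms , cs ++ ds) , n₂
  dj b    A        n with τ₁ n b A (suc n)
  ... | cs , n₁ = (pos n ∷ [] , cs) , n₁

  lt : Form → St (Lit × List Clause)
  lt (var p)        n = (pos p , []) , n
  lt (¬ₜ (var p))   n = (neg p , []) , n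
  lt A              n with τ₁ n true A (suc n)
  ... | cs , n₁ = (pos n , cs) , n₁

maxVar : Form → ℕ
maxVar (var p)  = p
maxVar trueₜ    = 0
maxVar falseₜ   = 0
maxVar (¬ₜ A)   = maxVar A
maxVar (A ∨ₜ B) = maxVar A ⊔ maxVar B
maxVar (A ∧ₜ B) = maxVar A ⊔ maxVar B
maxVar (A ⇒ₜ B) = maxVar A ⊔ maxVar B
maxVar (○ A)    = maxVar A
maxVar (◇ A)    = maxVar A
maxVar (□ A)    = maxVar A
maxVar (A 𝒰 B)  = maxVar A ⊔ maxVar B
maxVar (A 𝒲 B)  = maxVar A ⊔ maxVar B

-- τ₀[A] = □(start ⇒ y) ∧ τ₁[□(y ⇒ A)], y fresh; all fresh symbols are
-- strictly larger than every symbol occurring in A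
τ₀ : Form → List Clause
τ₀ A with suc (maxVar A)
... | y = initial (dor (pos y ∷ [])) ∷ Data.Product.proj₁ (τ₁ y true A (suc y))

-- The model σ′ extends σ by reading every fresh symbol y introduced by the translation as the
-- truth value, in σ, of the subformula that y renames (in the polarity in which it is renamed).
-- Fresh symbols lie above maxVar W, so σ′ agrees with σ on W. By induction on the formula, every
-- clause produced by τ₁[x ⇒ A] holds in σ′ as soon as x, read in σ′, implies A, read in σ; for the
-- top symbol y of τ₀ this is immediate since y is true exactly where W is, and start ⇒ y holds
-- because σ satisfies W at 0. Excluded middle is needed to justify clauses ¬x ∨ D and the clausal
-- forms of the negated connectives, such as ¬(A 𝒰 B) ≡ ¬B 𝒲 (¬B ∧ ¬A).
module Submission where

open import Defs
open import Level using (0ℓ)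
open import Axiom.ExcludedMiddle using (ExcludedMiddle)
open import Axiom.DoubleNegationElimination using (em⇒dne)
open import Data.Bool using (Bool; true; false; not)
open import Data.Empty using (⊥; ⊥-elim)
open import Data.List using (List; []; _∷_; _++_)
open import Data.List.Relation.Unary.All using ([]; _∷_)
open import Data.List.Relation.Unary.All.Properties using (++⁺)
open import Data.List.Relation.Unary.Any using (here; there)
open import Data.List.Relation.Unary.Any.Properties using (++⁺ˡ; ++⁺ʳ)
open import Data.Maybe using (just; nothing)
open import Data.Nat using (ℕ; suc; _+_; _≤_; _<_; _<?_; _⊔_; s≤s)
open import Data.Nat.Induction using (<-wellFounded)
open import Data.Nat.Properties
  using (≤-refl; ≤-trans; <⇒≤; <⇒≱; <-≤-trans; m≤n⇒m<n∨m≡n; n≤1+n; m≤n+m; m⊔n≤o⇒m≤o; m⊔n≤o⇒n≤o)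
open import Data.Product using (∃; _×_; _,_; proj₁; proj₂; map₁)
open import Data.Sum using (_⊎_; inj₁; inj₂; [_,_]′)
open import Data.Unit using (tt)
open import Function using (id; _∘_)
open import Function.Bundles using (_⇔_; mk⇔; Equivalence)
open import Induction.WellFounded using (Acc; acc)
open import Relation.Nullary using (¬_; yes; no)
open import Relation.Nullary.Negation using (contradiction)
open import Relation.Binary.PropositionalEquality using (_≡_; refl; sym; trans; subst)

open Equivalence using (to; from)

splice : ℕ → Model → Model → Model
splice k f g i p with p <? k
... | yes _ = f i p
... | no  _ = g i p

assign : ℕ → (ℕ → Set) → Model → Model
assign y P = splice (suc y) (λ i _ → P i)

blank : Model
blank _ _ = ⊥

AgreeOn : Model → ℕ → ℕ → Model → Set₁
AgreeOn ρ a c τ = ∀ i p → a ≤ p → p < c → ρ i p ≡ τ i p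

module _ {k : ℕ} {f g : Model} {i p : ℕ} where
  splice-< : p < k → splice k f g i p ≡ f i p
  splice-< p<k with p <? k
  ... | yes _   = refl
  ... | no  p≮k = contradiction p<k p≮k

  splice-≥ : k ≤ p → splice k f g i p ≡ g i p
  splice-≥ k≤p with p <? k
  ... | yes p<k = contradiction k≤p (<⇒≱ p<k)
  ... | no  _   = refl

module _ {ρ : Model} {a c : ℕ} where
  agreeOn-spliceˡ : ∀ {k f g} → AgreeOn ρ a c (splice k f g) → k ≤ c → AgreeOn ρ a k f
  agreeOn-spliceˡ ρ≈ k≤c i p a≤p p<k = trans (ρ≈ i p a≤p (<-≤-trans p<k k≤c)) (splice-< p<k)

  agreeOn-spliceʳ : ∀ {k f g} → AgreeOn ρ a c (splice k f g) → a ≤ k → AgreeOn ρ k c g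
  agreeOn-spliceʳ ρ≈ a≤k i p k≤p p<c = trans (ρ≈ i p (≤-trans a≤k k≤p) p<c) (splice-≥ k≤p)

  agreeOn-assign : ∀ {P g} → AgreeOn ρ a c (assign a P g) → a < c → ∀ i → ρ i a ⇔ P i
  agreeOn-assign {P} {g} ρ≈ a<c i = mk⇔ (subst id eq) (subst id (sym eq))
    where eq = trans (ρ≈ i a ≤-refl a<c) (splice-< {f = λ i _ → P i} {g} {p = a} ≤-refl)

  agreeOn-assign-rest : ∀ {P g} → AgreeOn ρ a c (assign a P g) → AgreeOn ρ (suc a) c g
  agreeOn-assign-rest ρ≈ = agreeOn-spliceʳ ρ≈ (n≤1+n a)

least : ExcludedMiddle 0ℓ → (Q : ℕ → Set) → ∀ {k} → Q k → ∃ λ m → Q m × (∀ j → j < m → ¬ Q j)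
least em Q = go (<-wellFounded _)
  where
    go : ∀ {k} → Acc _<_ k → Q k → ∃ λ m → Q m × (∀ j → j < m → ¬ Q j)
    go {k} (acc below) Qk with em {∃ λ j → j < k × Q j}
    ... | yes (j , j<k , Qj) = go (below j<k) Qj
    ... | no  ∄j             = k , Qk , λ j j<k Qj → ∄j (j , j<k , Qj)

signed : Bool → Form → Form
signed true  A = A
signed false A = ¬ₜ A

module Semantics (σ : Model) where
  ⟦_⟧ : Form → ℕ → Set
  ⟦ A ⟧ i = σ , i ⊨ A

  ¬◇⇒□¬ : ∀ A {i} → ⟦ ¬ₜ (◇ A) ⟧ i → ⟦ □ (¬ₜ A) ⟧ i
  ¬◇⇒□¬ A ¬◇A j i≤j Aj = ¬◇A (j , i≤j , Aj)

  unless-unfold : ∀ A B {i} → ⟦ A 𝒲 B ⟧ i → ⟦ B ⟧ i ⊎ ⟦ A ⟧ i × ⟦ A 𝒲 B ⟧ (suc i)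
  unless-unfold A B (inj₁ (k , i≤k , Bk , A<k)) with m≤n⇒m<n∨m≡n i≤k
  ... | inj₂ refl = inj₁ Bk
  ... | inj₁ i<k  = inj₂ (A<k _ ≤-refl i<k , inj₁ (k , i<k , Bk , λ j i<j → A<k j (<⇒≤ i<j)))
  unless-unfold A B {i} (inj₂ □A) = inj₂ (□A i ≤-refl , inj₂ λ j i<j → □A j (<⇒≤ i<j))

  module Classical (em : ExcludedMiddle 0ℓ) where
    dne : ∀ {P : Set} → ¬ ¬ P → P
    dne = em⇒dne em

    signed-¬ : ∀ b A {i} → ⟦ signed b (¬ₜ A) ⟧ i → ⟦ signed (not b) A ⟧ i
    signed-¬ true  A ¬A  = ¬A
    signed-¬ false A ¬¬A = dne ¬¬A

    ⇒-as-∨ : ∀ A B {i} → ⟦ A ⇒ₜ B ⟧ i → ⟦ ¬ₜ A ∨ₜ B ⟧ i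
    ⇒-as-∨ A B {i} A⇒B with em {⟦ A ⟧ i}
    ... | yes Ai = inj₂ (A⇒B Ai)
    ... | no ¬Ai = inj₁ ¬Ai

    ¬∧-as-∨ : ∀ A B {i} → ⟦ ¬ₜ (A ∧ₜ B) ⟧ i → ⟦ ¬ₜ A ∨ₜ ¬ₜ B ⟧ i
    ¬∧-as-∨ A B {i} ¬A∧B with em {⟦ A ⟧ i}
    ... | yes Ai = inj₂ λ Bi → ¬A∧B (Ai , Bi)
    ... | no ¬Ai = inj₁ ¬Ai

    ¬⇒-as-∧ : ∀ A B {i} → ⟦ ¬ₜ (A ⇒ₜ B) ⟧ i → ⟦ A ∧ₜ ¬ₜ B ⟧ i
    ¬⇒-as-∧ A B ¬A⇒B = dne (λ ¬Ai → ¬A⇒B (⊥-elim ∘ ¬Ai)) , λ Bi → ¬A⇒B (λ _ → Bi)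

    ¬□⇒◇¬ : ∀ A {i} → ⟦ ¬ₜ (□ A) ⟧ i → ⟦ ◇ (¬ₜ A) ⟧ i
    ¬□⇒◇¬ A ¬□A = dne λ ¬◇¬A → ¬□A λ k i≤k → dne λ ¬Ak → ¬◇¬A (k , i≤k , ¬Ak)

    -- At the first k ≥ i where A fails, A has held on [i, k), so B cannot have held on [i, k].
    ¬until∧◇¬⇒until : ∀ A B {i} → ⟦ ¬ₜ (A 𝒰 B) ⟧ i → ⟦ ◇ (¬ₜ A) ⟧ i → ⟦ (¬ₜ B) 𝒰 (¬ₜ B ∧ₜ ¬ₜ A) ⟧ i
    ¬until∧◇¬⇒until A B {i} ¬AUB (k , i≤k , ¬Ak)
      with least em (λ m → i ≤ m × ¬ ⟦ A ⟧ m) (i≤k , ¬Ak)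
    ... | m , (i≤m , ¬Am) , before = m , i≤m , (¬B i≤m ≤-refl , ¬Am) , λ j i≤j j<m → ¬B i≤j (<⇒≤ j<m)
      where
        ¬B : ∀ {j} → i ≤ j → j ≤ m → ¬ ⟦ B ⟧ j
        ¬B {j} i≤j j≤m Bj = ¬AUB (j , i≤j , Bj , λ l i≤l l<j →
          dne λ ¬Al → before l (<-≤-trans l<j j≤m) (i≤l , ¬Al))

    ¬until⇒unless : ∀ A B {i} → ⟦ ¬ₜ (A 𝒰 B) ⟧ i → ⟦ (¬ₜ B) 𝒲 (¬ₜ B ∧ₜ ¬ₜ A) ⟧ i
    ¬until⇒unless A B {i} ¬AUB with em {⟦ ◇ (¬ₜ A) ⟧ i}
    ... | yes ◇¬A = inj₁ (¬until∧◇¬⇒until A B ¬AUB ◇¬A)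
    ... | no ¬◇¬A = inj₂ λ j i≤j Bj → ¬AUB (j , i≤j , Bj , λ l i≤l _ →
                      dne λ ¬Al → ¬◇¬A (l , i≤l , ¬Al))

    ¬unless⇒until : ∀ A B {i} → ⟦ ¬ₜ (A 𝒲 B) ⟧ i → ⟦ (¬ₜ B) 𝒰 (¬ₜ B ∧ₜ ¬ₜ A) ⟧ i
    ¬unless⇒until A B ¬AWB = ¬until∧◇¬⇒until A B (¬AWB ∘ inj₁) (¬□⇒◇¬ A (¬AWB ∘ inj₂))

-- The last clauses of τ₁ for □ and ◇, and those of lt and dj, are catch-alls, which do not
-- reduce on a formula variable; each view records once, constructor by constructor, how they unfold.
data LitView : Form → Set where
  positive : ∀ p → LitView (var p)
  negative : ∀ p → LitView (¬ₜ var p)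
  compound : ∀ {A}
    → (∀ {x n} → τ₁ x true (□ A) n ≡ map₁ (proj₁ (alwaysLit x (pos n) (suc n)) ++_) (τ₁ n true A (2 + n)))
    → (∀ {x n} → τ₁ x true (◇ A) n ≡ map₁ (sometime (pos x ∷ []) (pos n) ∷_) (τ₁ n true A (suc n)))
    → (∀ {n} → lt A n ≡ map₁ (pos n ,_) (τ₁ n true A (suc n)))
    → LitView A

litView : ∀ A → LitView A
litView (var p)       = positive p
litView (¬ₜ var p)    = negative p
litView trueₜ         = compound refl refl refl
litView falseₜ        = compound refl refl refl
litView (¬ₜ trueₜ)    = compound refl refl refl
litView (¬ₜ falseₜ)   = compound refl refl refl
litView (¬ₜ (¬ₜ A))   = compound refl refl refl
litView (¬ₜ (A ∨ₜ B)) = compound refl refl refl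
litView (¬ₜ (A ∧ₜ B)) = compound refl refl refl
litView (¬ₜ (A ⇒ₜ B)) = compound refl refl refl
litView (¬ₜ (○ A))    = compound refl refl refl
litView (¬ₜ (◇ A))    = compound refl refl refl
litView (¬ₜ (□ A))    = compound refl refl refl
litView (¬ₜ (A 𝒰 B))  = compound refl refl refl
litView (¬ₜ (A 𝒲 B))  = compound refl refl refl
litView (A ∨ₜ B)      = compound refl refl refl
litView (A ∧ₜ B)      = compound refl refl refl
litView (A ⇒ₜ B)      = compound refl refl refl
litView (○ A)         = compound refl refl refl
litView (◇ A)         = compound refl refl refl
litView (□ A)         = compound refl refl refl
litView (A 𝒰 B)       = compound refl refl refl
litView (A 𝒲 B)       = compound refl refl refl

data DisjunctView : Bool → Form → Set where
  atom        : ∀ {b} p → DisjunctView b (var p)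
  negation    : ∀ {b} A → DisjunctView b (¬ₜ A)
  disjunction : ∀ A B → DisjunctView true (A ∨ₜ B)
  named       : ∀ {b A} → (∀ {n} → dj b A n ≡ map₁ (pos n ∷ [] ,_) (τ₁ n b A (suc n))) → DisjunctView b A

disjunctView : ∀ b A → DisjunctView b A
disjunctView b     (var p)  = atom p
disjunctView b     (¬ₜ A)   = negation A
disjunctView true  (A ∨ₜ B) = disjunction A B
disjunctView false (A ∨ₜ B) = named refl
disjunctView b     trueₜ    = named refl
disjunctView b     falseₜ   = named refl
disjunctView b     (A ∧ₜ B) = named refl
disjunctView b     (A ⇒ₜ B) = named refl
disjunctView b     (○ A)    = named refl
disjunctView b     (◇ A)    = named refl
disjunctView b     (□ A)    = named refl
disjunctView b     (A 𝒰 B)  = named refl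
disjunctView b     (A 𝒲 B)  = named refl

mutual
  τ₁-inflationary : ∀ x b A n → n ≤ proj₂ (τ₁ x b A n)
  τ₁-inflationary x b     (var p)  n = ≤-refl
  τ₁-inflationary x true  trueₜ    n = ≤-refl
  τ₁-inflationary x false falseₜ   n = ≤-refl
  τ₁-inflationary x true  falseₜ   n = ≤-refl
  τ₁-inflationary x false trueₜ    n = ≤-refl
  τ₁-inflationary x b     (¬ₜ A)   n = τ₁-inflationary x (not b) A n
  τ₁-inflationary x true  (A ∧ₜ B) n = ≤-trans (τ₁-inflationary x true A n) (τ₁-inflationary x true B _)
  τ₁-inflationary x false (A ∨ₜ B) n = ≤-trans (τ₁-inflationary x false A n) (τ₁-inflationary x false B _)
  τ₁-inflationary x false (A ⇒ₜ B) n = ≤-trans (τ₁-inflationary x true A n) (τ₁-inflationary x false B _)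
  τ₁-inflationary x true  (A ∨ₜ B) n = ≤-trans (dj-inflationary true A n) (dj-inflationary true B _)
  τ₁-inflationary x true  (A ⇒ₜ B) n = ≤-trans (dj-inflationary false A n) (dj-inflationary true B _)
  τ₁-inflationary x false (A ∧ₜ B) n = ≤-trans (dj-inflationary false A n) (dj-inflationary false B _)
  τ₁-inflationary x true  (○ A)    n with litDisj A
  ... | just _  = ≤-refl
  ... | nothing = ≤-trans (n≤1+n n) (τ₁-inflationary n true A (suc n))
  τ₁-inflationary x false (○ A)    n = ≤-trans (n≤1+n n) (τ₁-inflationary n false A (suc n))
  τ₁-inflationary x true  (□ A)    n with litView A
  ... | positive _ = n≤1+n n
  ... | negative _ = n≤1+n n
  ... | compound □-eq _ _ rewrite □-eq {x} {n} = ≤-trans (m≤n+m n 2) (τ₁-inflationary n true A (2 + n))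
  τ₁-inflationary x false (□ A)    n = ≤-trans (n≤1+n n) (τ₁-inflationary n false A (suc n))
  τ₁-inflationary x true  (◇ A)    n with litView A
  ... | positive _ = ≤-refl
  ... | negative _ = ≤-refl
  ... | compound _ ◇-eq _ rewrite ◇-eq {x} {n} = ≤-trans (n≤1+n n) (τ₁-inflationary n true A (suc n))
  τ₁-inflationary x false (◇ A)    n = ≤-trans (m≤n+m n 2) (τ₁-inflationary n false A (2 + n))
  τ₁-inflationary x true  (A 𝒰 B)  n =
    ≤-trans (lt-inflationary A n) (≤-trans (lt-inflationary B _) (n≤1+n _))
  τ₁-inflationary x true  (A 𝒲 B)  n =
    ≤-trans (lt-inflationary A n) (≤-trans (lt-inflationary B _) (n≤1+n _))
  τ₁-inflationary x false (A 𝒰 B)  n =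
    ≤-trans (m≤n+m n 4) (≤-trans (τ₁-inflationary n false B _) (τ₁-inflationary (2 + n) false A _))
  τ₁-inflationary x false (A 𝒲 B)  n =
    ≤-trans (m≤n+m n 4) (≤-trans (τ₁-inflationary n false B _) (τ₁-inflationary (2 + n) false A _))

  dj-inflationary : ∀ b A n → n ≤ proj₂ (dj b A n)
  dj-inflationary b A n with disjunctView b A
  ... | atom _            = ≤-refl
  ... | negation C        = dj-inflationary (not b) C n
  ... | disjunction C D   = ≤-trans (dj-inflationary true C n) (dj-inflationary true D _)
  ... | named eq rewrite eq {n} = ≤-trans (n≤1+n n) (τ₁-inflationary n b A (suc n))

  lt-inflationary : ∀ A n → n ≤ proj₂ (lt A n)
  lt-inflationary A n with litView A
  ... | positive _ = ≤-refl
  ... | negative _ = ≤-refl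
  ... | compound _ _ lt-eq rewrite lt-eq {n} = ≤-trans (n≤1+n n) (τ₁-inflationary n true A (suc n))

-- naming x b A n interprets the symbols in [n, proj₂ (τ₁ x b A n)) allocated by τ₁ x b A n.
module Naming (σ : Model) where
  open Semantics σ using (⟦_⟧)

  mutual
    naming : ℕ → Bool → Form → ℕ → Model
    naming x b     (var p)  n = blank
    naming x b     trueₜ    n = blank
    naming x b     falseₜ   n = blank
    naming x b     (¬ₜ A)   n = naming x (not b) A n
    naming x true  (A ∧ₜ B) n = splice n₁ (naming x true A n) (naming x true B n₁)
      where n₁ = proj₂ (τ₁ x true A n)
    naming x false (A ∨ₜ B) n = splice n₁ (naming x false A n) (naming x false B n₁)
      where n₁ = proj₂ (τ₁ x false A n)
    naming x false (A ⇒ₜ B) n = splice n₁ (naming x true A n) (naming x false B n₁)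
      where n₁ = proj₂ (τ₁ x true A n)
    naming x true  (A ∨ₜ B) n = splice n₁ (namingDj true A n) (namingDj true B n₁)
      where n₁ = proj₂ (dj true A n)
    naming x true  (A ⇒ₜ B) n = splice n₁ (namingDj false A n) (namingDj true B n₁)
      where n₁ = proj₂ (dj false A n)
    naming x false (A ∧ₜ B) n = splice n₁ (namingDj false A n) (namingDj false B n₁)
      where n₁ = proj₂ (dj false A n)
    naming x true  (○ A)    n with litDisj A
    ... | just _  = blank
    ... | nothing = assign n ⟦ A ⟧ (naming n true A (suc n))
    naming x false (○ A)    n = assign n ⟦ ¬ₜ A ⟧ (naming n false A (suc n))
    naming x true  (□ A)    n with litView A
    ... | positive p = assign n ⟦ □ var p ⟧ blank
    ... | negative p = assign n ⟦ □ (¬ₜ var p) ⟧ blank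
    ... | compound _ _ _ = assign n ⟦ A ⟧ (assign (suc n) ⟦ □ A ⟧ (naming n true A (2 + n)))
    naming x false (□ A)    n = assign n ⟦ ¬ₜ A ⟧ (naming n false A (suc n))
    naming x true  (◇ A)    n with litView A
    ... | compound _ _ _ = assign n ⟦ A ⟧ (naming n true A (suc n))
    ... | _              = blank
    naming x false (◇ A)    n = assign n ⟦ ¬ₜ A ⟧ (assign (suc n) ⟦ □ (¬ₜ A) ⟧ (naming n false A (2 + n)))
    naming x true  (A 𝒰 B)  n = namingUntil A B n
    naming x true  (A 𝒲 B)  n = namingUntil A B n
    naming x false (A 𝒰 B)  n = namingNegUntil A B n
    naming x false (A 𝒲 B)  n = namingNegUntil A B n

    namingDj : Bool → Form → ℕ → Model
    namingDj b A n with disjunctView b A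
    ... | atom _          = blank
    ... | negation C      = namingDj (not b) C n
    ... | disjunction C D = splice n₁ (namingDj true C n) (namingDj true D n₁)
      where n₁ = proj₂ (dj true C n)
    ... | named _         = assign n ⟦ signed b A ⟧ (naming n b A (suc n))

    namingLt : Form → ℕ → Model
    namingLt A n with litView A
    ... | compound _ _ _ = assign n ⟦ A ⟧ (naming n true A (suc n))
    ... | _              = blank

    namingUntil : Form → Form → ℕ → Model
    namingUntil A B n =
      splice n₁ (namingLt A n) (splice n₂ (namingLt B n₁) (assign n₂ ⟦ ○ (A 𝒲 B) ⟧ blank))
      where
        n₁ = proj₂ (lt A n)
        n₂ = proj₂ (lt B n₁)

    -- n, 1 + n, 2 + n are the symbols y, v, z of rule (2) for ¬(A 𝒰 B) and ¬(A 𝒲 B), and 3 + n is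
    -- the fresh symbol of rule (3) for the resulting y 𝒲 v or y 𝒰 v.
    namingNegUntil : Form → Form → ℕ → Model
    namingNegUntil A B n =
      assign n ⟦ ¬ₜ B ⟧ (assign (1 + n) ⟦ ¬ₜ B ∧ₜ ¬ₜ A ⟧ (assign (2 + n) ⟦ ¬ₜ A ⟧
        (assign (3 + n) ⟦ ○ ((¬ₜ B) 𝒲 (¬ₜ B ∧ₜ ¬ₜ A)) ⟧
          (splice n₂ (naming n false B (4 + n)) (naming (2 + n) false A n₂)))))
      where n₂ = proj₂ (τ₁ n false B (4 + n))

module Soundness (em : ExcludedMiddle 0ℓ) (σ : Model) (M : ℕ) (ρ : Model)
                 (ρ≈σ : ∀ i p → p ≤ M → ρ i p ≡ σ i p) where
  open Semantics σ
  open Classical em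
  open Naming σ

  infix 4 _⇒⟦_⟧ ⟦_⟧⇒ₗ_ ⟦_⟧⇒∨_ _names_

  _⇒⟦_⟧ : ℕ → Form → Set
  x ⇒⟦ F ⟧ = ∀ i → ρ i x → ⟦ F ⟧ i

  ⟦_⟧⇒ₗ_ : Form → Lit → Set
  ⟦ F ⟧⇒ₗ l = ∀ i → ⟦ F ⟧ i → ρ , i ⊨ₗ l

  ⟦_⟧⇒∨_ : Form → List Lit → Set
  ⟦ F ⟧⇒∨ ls = ∀ i → ⟦ F ⟧ i → ρ , i ⊨d dor ls

  _names_ : ℕ → Form → Set
  y names F = ∀ i → ρ i y ⇔ ⟦ F ⟧ i

  Represents : Form → List Lit × List Clause → Set
  Represents F (ls , cs) = ⟦ F ⟧⇒∨ ls × ρ , 0 ⊨c cs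

  RepresentsLit : Form → Lit × List Clause → Set
  RepresentsLit F (l , cs) = ⟦ F ⟧⇒ₗ l × ρ , 0 ⊨c cs

  ⊔≤ˡ : ∀ {m n} → m ⊔ n ≤ M → m ≤ M
  ⊔≤ˡ = m⊔n≤o⇒m≤o _ _

  ⊔≤ʳ : ∀ {m n} → m ⊔ n ≤ M → n ≤ M
  ⊔≤ʳ = m⊔n≤o⇒n≤o _ _

  var⇒lit : ∀ b {p} → p ≤ M → ⟦ signed b (var p) ⟧⇒ₗ lit b p
  var⇒lit true  {p} p≤M i = subst id (sym (ρ≈σ i p p≤M))
  var⇒lit false {p} p≤M i ¬σp = ¬σp ∘ subst id (ρ≈σ i p p≤M)

  ∨⇒++ : ∀ F G {ls ms} → ⟦ F ⟧⇒∨ ls → ⟦ G ⟧⇒∨ ms → ⟦ F ∨ₜ G ⟧⇒∨ ls ++ ms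
  ∨⇒++ F G {ls} F⇒ G⇒ i = [ ++⁺ˡ ∘ F⇒ i , ++⁺ʳ ls ∘ G⇒ i ]′

  litDisj-sound : ∀ A {ls} → maxVar A ≤ M → litDisj A ≡ just ls → ⟦ A ⟧⇒∨ ls
  litDisj-sound (var p)    ≤M refl i = here ∘ var⇒lit true ≤M i
  litDisj-sound (¬ₜ var p) ≤M refl i = here ∘ var⇒lit false ≤M i
  litDisj-sound (A ∨ₜ B)   ≤M eq with litDisj A in eqA | litDisj B in eqB | eq
  ... | just _  | just _  | refl = ∨⇒++ A B (litDisj-sound A (⊔≤ˡ ≤M) eqA) (litDisj-sound B (⊔≤ʳ ≤M) eqB)
  ... | nothing | _       | ()
  ... | just _  | nothing | ()
  litDisj-sound trueₜ         _ ()
  litDisj-sound falseₜ        _ ()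
  litDisj-sound (¬ₜ trueₜ)    _ ()
  litDisj-sound (¬ₜ falseₜ)   _ ()
  litDisj-sound (¬ₜ (¬ₜ _))   _ ()
  litDisj-sound (¬ₜ (_ ∨ₜ _)) _ ()
  litDisj-sound (¬ₜ (_ ∧ₜ _)) _ ()
  litDisj-sound (¬ₜ (_ ⇒ₜ _)) _ ()
  litDisj-sound (¬ₜ (○ _))    _ ()
  litDisj-sound (¬ₜ (◇ _))    _ ()
  litDisj-sound (¬ₜ (□ _))    _ ()
  litDisj-sound (¬ₜ (_ 𝒰 _))  _ ()
  litDisj-sound (¬ₜ (_ 𝒲 _))  _ ()
  litDisj-sound (_ ∧ₜ _)      _ ()
  litDisj-sound (_ ⇒ₜ _)      _ ()
  litDisj-sound (○ _)         _ ()
  litDisj-sound (◇ _)         _ ()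
  litDisj-sound (□ _)         _ ()
  litDisj-sound (_ 𝒰 _)       _ ()
  litDisj-sound (_ 𝒲 _)       _ ()

  base-sat : ∀ x ls → (∀ j → ρ j x → ρ , j ⊨d dor ls) → ρ , 0 ⊨c base x ls
  base-sat x ls x⇒ls = (λ j _ _ → holds j) ∷ (λ j _ _ → holds (suc j)) ∷ []
    where
      holds : ∀ j → ρ , j ⊨d dor (neg x ∷ ls)
      holds j with em {ρ j x}
      ... | yes x̂ = there (x⇒ls j x̂)
      ... | no ¬x̂ = here ¬x̂

  baseTrue-sat : ρ , 0 ⊨c baseTrue
  baseTrue-sat = (λ _ _ _ → tt) ∷ (λ _ _ _ → tt) ∷ []

  next-sat : ∀ {x} F {ls} → x ⇒⟦ ○ F ⟧ → ⟦ F ⟧⇒∨ ls → ρ , 0 ⊨□ step (pos x ∷ []) (dor ls)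
  next-sat F x⇒○F F⇒ls j _ (x̂ ∷ []) = F⇒ls (suc j) (x⇒○F j x̂)

  sometime-sat : ∀ {x} F {l} → x ⇒⟦ ◇ F ⟧ → ⟦ F ⟧⇒ₗ l → ρ , 0 ⊨□ sometime (pos x ∷ []) l
  sometime-sat F x⇒◇F F⇒l j _ (x̂ ∷ []) with x⇒◇F j x̂
  ... | k , j≤k , Fk = k , j≤k , F⇒l k Fk

  alwaysLit-sat : ∀ {x} F {l y} → x ⇒⟦ □ F ⟧ → ⟦ F ⟧⇒ₗ l → y names □ F
                → ρ , 0 ⊨c proj₁ (alwaysLit x l y)
  alwaysLit-sat {x} F x⇒□F F⇒l y□F =
    ++⁺ (base-sat x _ λ j x̂ → here (F⇒l j (x⇒□F j x̂ j ≤-refl)))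
        (++⁺ (base-sat x _ λ j x̂ → here (from (y□F j) (x⇒□F j x̂)))
             ((λ { j _ (ŷ ∷ []) → here (F⇒l (suc j) (to (y□F j) ŷ (suc j) (n≤1+n j))) })
             ∷ (λ { j _ (ŷ ∷ []) → here (from (y□F (suc j)) λ k j<k → to (y□F j) ŷ k (<⇒≤ j<k)) })
             ∷ []))

  unlessLit-sat : ∀ {x} A B {l m y} → x ⇒⟦ A 𝒲 B ⟧ → ⟦ A ⟧⇒ₗ l → ⟦ B ⟧⇒ₗ m
                → y names ○ (A 𝒲 B) → ρ , 0 ⊨c proj₁ (unlessLit x l m y)
  unlessLit-sat {x} A B {l} {m} {y} x⇒AWB A⇒l B⇒m y○AWB =
    ++⁺ (base-sat x _ λ j → proj₁ ∘ now j ∘ x⇒AWB j)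
        (++⁺ (base-sat x _ λ j → proj₂ ∘ now j ∘ x⇒AWB j)
             ((λ { j _ (ŷ ∷ []) → proj₁ (now (suc j) (to (y○AWB j) ŷ)) })
             ∷ (λ { j _ (ŷ ∷ []) → proj₂ (now (suc j) (to (y○AWB j) ŷ)) })
             ∷ []))
    where
      now : ∀ j → ⟦ A 𝒲 B ⟧ j → ρ , j ⊨d dor (l ∷ m ∷ []) × ρ , j ⊨d dor (pos y ∷ m ∷ [])
      now j AWB with unless-unfold A B AWB
      ... | inj₁ Bj          = there (here (B⇒m j Bj)) , there (here (B⇒m j Bj))
      ... | inj₂ (Aj , AWB′) = here (A⇒l j Aj) , here (from (y○AWB j) AWB′)

  untilLit-sat : ∀ {x} A B {l m y} → x ⇒⟦ A 𝒰 B ⟧ → ⟦ A ⟧⇒ₗ l → ⟦ B ⟧⇒ₗ m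
               → y names ○ (A 𝒲 B) → ρ , 0 ⊨c proj₁ (untilLit x l m y)
  untilLit-sat A B {m = m} x⇒AUB A⇒l B⇒m y○AWB =
    sometime-sat B {m} (λ j x̂ → let k , j≤k , Bk , _ = x⇒AUB j x̂ in k , j≤k , Bk) B⇒m
    ∷ unlessLit-sat A B (λ j → inj₁ ∘ x⇒AUB j) A⇒l B⇒m y○AWB

  mutual
    τ₁-sound : ∀ x b A n → maxVar A ≤ M → AgreeOn ρ n (proj₂ (τ₁ x b A n)) (naming x b A n)
             → x ⇒⟦ signed b A ⟧ → ρ , 0 ⊨c proj₁ (τ₁ x b A n)
    τ₁-sound x b     (var p)  n ≤M _ x⇒ = base-sat x _ λ j → here ∘ var⇒lit b ≤M j ∘ x⇒ j
    τ₁-sound x true  trueₜ    n _ _ _  = baseTrue-sat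
    τ₁-sound x false falseₜ   n _ _ _  = baseTrue-sat
    τ₁-sound x true  falseₜ   n _ _ x⇒ = base-sat x [] λ j → ⊥-elim ∘ x⇒ j
    τ₁-sound x false trueₜ    n _ _ x⇒ = base-sat x [] λ j x̂ → ⊥-elim (x⇒ j x̂ tt)
    τ₁-sound x b     (¬ₜ A)   n ≤M ρ≈ x⇒ = τ₁-sound x (not b) A n ≤M ρ≈ λ j → signed-¬ b A ∘ x⇒ j
    τ₁-sound x true  (A ∧ₜ B) n ≤M ρ≈ x⇒ = conjunction-sound x true A true B n ≤M ρ≈ x⇒
    τ₁-sound x false (A ∨ₜ B) n ≤M ρ≈ x⇒ =
      conjunction-sound x false A false B n ≤M ρ≈ λ j x̂ → x⇒ j x̂ ∘ inj₁ , x⇒ j x̂ ∘ inj₂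
    τ₁-sound x false (A ⇒ₜ B) n ≤M ρ≈ x⇒ =
      conjunction-sound x true A false B n ≤M ρ≈ λ j → ¬⇒-as-∧ A B ∘ x⇒ j
    τ₁-sound x true  (A ∨ₜ B) n ≤M ρ≈ x⇒ = disjunction-sound x true A true B n ≤M ρ≈ x⇒
    τ₁-sound x true  (A ⇒ₜ B) n ≤M ρ≈ x⇒ =
      disjunction-sound x false A true B n ≤M ρ≈ λ j → ⇒-as-∨ A B ∘ x⇒ j
    τ₁-sound x false (A ∧ₜ B) n ≤M ρ≈ x⇒ =
      disjunction-sound x false A false B n ≤M ρ≈ λ j → ¬∧-as-∨ A B ∘ x⇒ j
    τ₁-sound x true  (○ A)    n ≤M ρ≈ x⇒ with litDisj A in eq
    ... | just _  = next-sat A x⇒ (litDisj-sound A ≤M eq) ∷ []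
    ... | nothing = next-sound x true A n ≤M ρ≈ x⇒
    τ₁-sound x false (○ A)    n ≤M ρ≈ x⇒ = next-sound x false A n ≤M ρ≈ x⇒
    τ₁-sound x true  (□ A)    n ≤M ρ≈ x⇒ with litView A
    ... | positive p = alwaysLit-sat (var p) x⇒ (var⇒lit true ≤M) (agreeOn-assign ρ≈ ≤-refl)
    ... | negative p = alwaysLit-sat (¬ₜ var p) x⇒ (var⇒lit false ≤M) (agreeOn-assign ρ≈ ≤-refl)
    ... | compound □-eq _ _ rewrite □-eq {x} {n} = always-sound x true A n ≤M ρ≈ x⇒
    τ₁-sound x false (□ A)    n ≤M ρ≈ x⇒ = eventually-sound x false A n ≤M ρ≈ λ j → ¬□⇒◇¬ A ∘ x⇒ j
    τ₁-sound x true  (◇ A)    n ≤M ρ≈ x⇒ with litView A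
    ... | positive p = sometime-sat (var p) x⇒ (var⇒lit true ≤M) ∷ []
    ... | negative p = sometime-sat (¬ₜ var p) {neg p} x⇒ (var⇒lit false ≤M) ∷ []
    ... | compound _ ◇-eq _ rewrite ◇-eq {x} {n} = eventually-sound x true A n ≤M ρ≈ x⇒
    τ₁-sound x false (◇ A)    n ≤M ρ≈ x⇒ = always-sound x false A n ≤M ρ≈ λ j → ¬◇⇒□¬ A ∘ x⇒ j
    τ₁-sound x true  (A 𝒰 B)  n ≤M ρ≈ x⇒ =
      let (A⇒l , cs) , (B⇒m , ds) , y = until-operands-sound A B n ≤M ρ≈
      in ++⁺ (untilLit-sat A B x⇒ A⇒l B⇒m y) (++⁺ cs ds)
    τ₁-sound x true  (A 𝒲 B)  n ≤M ρ≈ x⇒ =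
      let (A⇒l , cs) , (B⇒m , ds) , y = until-operands-sound A B n ≤M ρ≈
      in ++⁺ (unlessLit-sat A B x⇒ A⇒l B⇒m y) (++⁺ cs ds)
    τ₁-sound x false (A 𝒰 B)  n ≤M ρ≈ x⇒ =
      let y , v , w , cs = ¬until-operands-sound A B n ≤M ρ≈
      in ++⁺ (unlessLit-sat (¬ₜ B) (¬ₜ B ∧ₜ ¬ₜ A) (λ j → ¬until⇒unless A B ∘ x⇒ j)
                            (λ i → from (y i)) (λ i → from (v i)) w) cs
    τ₁-sound x false (A 𝒲 B)  n ≤M ρ≈ x⇒ =
      let y , v , w , cs = ¬until-operands-sound A B n ≤M ρ≈
      in ++⁺ (untilLit-sat (¬ₜ B) (¬ₜ B ∧ₜ ¬ₜ A) (λ j → ¬unless⇒until A B ∘ x⇒ j)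
                           (λ i → from (y i)) (λ i → from (v i)) w) cs

    dj-sound : ∀ b A n → maxVar A ≤ M → AgreeOn ρ n (proj₂ (dj b A n)) (namingDj b A n)
             → Represents (signed b A) (proj₁ (dj b A n))
    dj-sound b A n ≤M ρ≈ with disjunctView b A
    ... | atom _          = (λ i → here ∘ var⇒lit b ≤M i) , []
    ... | negation C      = map₁ (λ C⇒ i → C⇒ i ∘ signed-¬ b C) (dj-sound (not b) C n ≤M ρ≈)
    ... | disjunction C D =
      let C⇒ , cs = dj-sound true C n (⊔≤ˡ ≤M) (agreeOn-spliceˡ ρ≈ (dj-inflationary true D _))
          D⇒ , ds = dj-sound true D _ (⊔≤ʳ ≤M) (agreeOn-spliceʳ ρ≈ (dj-inflationary true C n))
      in ∨⇒++ C D C⇒ D⇒ , ++⁺ cs ds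
    ... | named eq rewrite eq {n} =
      let nA , cs = fresh-sound b A n ≤M ρ≈ in (λ i → here ∘ from (nA i)) , cs

    lt-sound : ∀ A n → maxVar A ≤ M → AgreeOn ρ n (proj₂ (lt A n)) (namingLt A n)
             → RepresentsLit A (proj₁ (lt A n))
    lt-sound A n ≤M ρ≈ with litView A
    ... | positive _ = var⇒lit true ≤M , []
    ... | negative _ = var⇒lit false ≤M , []
    ... | compound _ _ lt-eq rewrite lt-eq {n} =
      let nA , cs = fresh-sound true A n ≤M ρ≈ in (λ i → from (nA i)) , cs

    fresh-sound : ∀ b A n → maxVar A ≤ M
                → AgreeOn ρ n (proj₂ (τ₁ n b A (suc n))) (assign n ⟦ signed b A ⟧ (naming n b A (suc n)))
                → n names signed b A × ρ , 0 ⊨c proj₁ (τ₁ n b A (suc n))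
    fresh-sound b A n ≤M ρ≈ = nA , τ₁-sound n b A (suc n) ≤M (agreeOn-assign-rest ρ≈) λ i → to (nA i)
      where nA = agreeOn-assign ρ≈ (τ₁-inflationary n b A (suc n))

    next-sound : ∀ x b A n → maxVar A ≤ M
               → AgreeOn ρ n (proj₂ (τ₁ n b A (suc n))) (assign n ⟦ signed b A ⟧ (naming n b A (suc n)))
               → x ⇒⟦ ○ signed b A ⟧
               → ρ , 0 ⊨c (step (pos x ∷ []) (dor (pos n ∷ [])) ∷ proj₁ (τ₁ n b A (suc n)))
    next-sound x b A n ≤M ρ≈ x⇒ =
      let nA , cs = fresh-sound b A n ≤M ρ≈ in next-sat (signed b A) x⇒ (λ i → here ∘ from (nA i)) ∷ cs

    eventually-sound : ∀ x b A n → maxVar A ≤ M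
                     → AgreeOn ρ n (proj₂ (τ₁ n b A (suc n))) (assign n ⟦ signed b A ⟧ (naming n b A (suc n)))
                     → x ⇒⟦ ◇ signed b A ⟧
                     → ρ , 0 ⊨c (sometime (pos x ∷ []) (pos n) ∷ proj₁ (τ₁ n b A (suc n)))
    eventually-sound x b A n ≤M ρ≈ x⇒ =
      let nA , cs = fresh-sound b A n ≤M ρ≈ in sometime-sat (signed b A) x⇒ (λ i → from (nA i)) ∷ cs

    always-sound : ∀ x b A n → maxVar A ≤ M
                 → AgreeOn ρ n (proj₂ (τ₁ n b A (2 + n)))
                     (assign n ⟦ signed b A ⟧ (assign (suc n) ⟦ □ signed b A ⟧ (naming n b A (2 + n))))
                 → x ⇒⟦ □ signed b A ⟧
                 → ρ , 0 ⊨c (proj₁ (alwaysLit x (pos n) (suc n)) ++ proj₁ (τ₁ n b A (2 + n)))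
    always-sound x b A n ≤M ρ≈ x⇒ =
      ++⁺ (alwaysLit-sat (signed b A) x⇒ (λ i → from (nA i)) (agreeOn-assign ρ≈′ bound))
          (τ₁-sound n b A (2 + n) ≤M (agreeOn-assign-rest ρ≈′) λ i → to (nA i))
      where
        bound = τ₁-inflationary n b A (2 + n)
        nA = agreeOn-assign ρ≈ (≤-trans (n≤1+n _) bound)
        ρ≈′ = agreeOn-assign-rest ρ≈

    conjunction-sound : ∀ x bA A bB B n → maxVar A ⊔ maxVar B ≤ M →
                        let n₁ = proj₂ (τ₁ x bA A n) in
                        AgreeOn ρ n (proj₂ (τ₁ x bB B n₁)) (splice n₁ (naming x bA A n) (naming x bB B n₁))
                      → x ⇒⟦ signed bA A ∧ₜ signed bB B ⟧
                      → ρ , 0 ⊨c (proj₁ (τ₁ x bA A n) ++ proj₁ (τ₁ x bB B n₁))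
    conjunction-sound x bA A bB B n ≤M ρ≈ x⇒ =
      ++⁺ (τ₁-sound x bA A n (⊔≤ˡ ≤M) (agreeOn-spliceˡ ρ≈ (τ₁-inflationary x bB B _)) λ j → proj₁ ∘ x⇒ j)
          (τ₁-sound x bB B _ (⊔≤ʳ ≤M) (agreeOn-spliceʳ ρ≈ (τ₁-inflationary x bA A n)) λ j → proj₂ ∘ x⇒ j)

    disjunction-sound : ∀ x bA A bB B n → maxVar A ⊔ maxVar B ≤ M →
                        let ((ls , cs) , n₁) = dj bA A n
                            ((ms , ds) , _)  = dj bB B n₁ in
                        AgreeOn ρ n (proj₂ (dj bB B n₁)) (splice n₁ (namingDj bA A n) (namingDj bB B n₁))
                      → x ⇒⟦ signed bA A ∨ₜ signed bB B ⟧
                      → ρ , 0 ⊨c (base x (ls ++ ms) ++ cs ++ ds)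
    disjunction-sound x bA A bB B n ≤M ρ≈ x⇒ =
      let A⇒ , cs = dj-sound bA A n (⊔≤ˡ ≤M) (agreeOn-spliceˡ ρ≈ (dj-inflationary bB B _))
          B⇒ , ds = dj-sound bB B _ (⊔≤ʳ ≤M) (agreeOn-spliceʳ ρ≈ (dj-inflationary bA A n))
      in ++⁺ (base-sat x _ λ j → ∨⇒++ (signed bA A) (signed bB B) A⇒ B⇒ j ∘ x⇒ j) (++⁺ cs ds)

    until-operands-sound : ∀ A B n → maxVar A ⊔ maxVar B ≤ M →
                           let n₁ = proj₂ (lt A n)
                               n₂ = proj₂ (lt B n₁) in
                           AgreeOn ρ n (suc n₂) (namingUntil A B n)
                         → RepresentsLit A (proj₁ (lt A n)) × RepresentsLit B (proj₁ (lt B n₁))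
                           × n₂ names ○ (A 𝒲 B)
    until-operands-sound A B n ≤M ρ≈ =
        lt-sound A n (⊔≤ˡ ≤M) (agreeOn-spliceˡ ρ≈ (≤-trans (lt-inflationary B _) (n≤1+n _)))
      , lt-sound B _ (⊔≤ʳ ≤M) (agreeOn-spliceˡ ρ≈′ (n≤1+n _))
      , agreeOn-assign (agreeOn-spliceʳ ρ≈′ (lt-inflationary B _)) ≤-refl
      where ρ≈′ = agreeOn-spliceʳ ρ≈ (lt-inflationary A n)

    ¬until-operands-sound : ∀ A B n → maxVar A ⊔ maxVar B ≤ M →
                            let n₂ = proj₂ (τ₁ n false B (4 + n)) in
                            AgreeOn ρ n (proj₂ (τ₁ (2 + n) false A n₂)) (namingNegUntil A B n)
                          → n names ¬ₜ B × 1 + n names ¬ₜ B ∧ₜ ¬ₜ A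
                            × 3 + n names ○ ((¬ₜ B) 𝒲 (¬ₜ B ∧ₜ ¬ₜ A))
                            × ρ , 0 ⊨c (proj₁ (τ₁ n false B (4 + n)) ++ base (1 + n) (pos n ∷ [])
                                        ++ base (1 + n) (pos (2 + n) ∷ []) ++ proj₁ (τ₁ (2 + n) false A n₂))
    ¬until-operands-sound A B n ≤M ρ≈ =
      y , v , w ,
      ++⁺ (τ₁-sound n false B (4 + n) (⊔≤ʳ ≤M) (agreeOn-spliceˡ ρ≈₄ (τ₁-inflationary (2 + n) false A _))
                    λ i → to (y i))
          (++⁺ (base-sat (1 + n) _ λ j → here ∘ from (y j) ∘ proj₁ ∘ to (v j))
               (++⁺ (base-sat (1 + n) _ λ j → here ∘ from (z j) ∘ proj₂ ∘ to (v j))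
                    (τ₁-sound (2 + n) false A _ (⊔≤ˡ ≤M)
                              (agreeOn-spliceʳ ρ≈₄ (τ₁-inflationary n false B (4 + n))) λ i → to (z i))))
      where
        bound = ≤-trans (τ₁-inflationary n false B (4 + n)) (τ₁-inflationary (2 + n) false A _)
        ρ≈₁ = agreeOn-assign-rest ρ≈
        ρ≈₂ = agreeOn-assign-rest ρ≈₁
        ρ≈₃ = agreeOn-assign-rest ρ≈₂
        ρ≈₄ = agreeOn-assign-rest ρ≈₃
        y = agreeOn-assign ρ≈  (≤-trans (m≤n+m (1 + n) 3) bound)
        v = agreeOn-assign ρ≈₁ (≤-trans (m≤n+m (2 + n) 2) bound)
        z = agreeOn-assign ρ≈₂ (≤-trans (n≤1+n (3 + n)) bound)
        w = agreeOn-assign ρ≈₃ bound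

lemma4 : ExcludedMiddle 0ℓ → (W : Form) (σ : Model) → σ , 0 ⊨ W →
    ∃ λ (σ′ : Model) → σ′ , 0 ⊨c τ₀ W
lemma4 em W σ σ⊨W = σ′ , start⇒y ∷ proj₂ sound
  where
    open Semantics σ using (⟦_⟧)
    open Naming σ
    y = suc (maxVar W)
    σ′ : Model
    σ′ = splice y σ (assign y ⟦ W ⟧ (naming y true W (suc y)))
    open Soundness em σ (maxVar W) σ′ (λ i p p≤M → splice-< (s≤s p≤M))
    sound = fresh-sound true W y ≤-refl λ i p y≤p _ → splice-≥ y≤p
    start⇒y : σ′ , 0 ⊨□ initial (dor (pos y ∷ []))
    start⇒y _ _ refl = here (from (proj₁ sound 0) σ⊨W)
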